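{- Let $n\geq 3$ be an integer and let $(x_1,\ldots,x_n)$ be positive integers with $x_1\leq x_2\leq\cdots\leq x_n$ satisfying $\sigma_2(x_1,\ldots,x_n)=\sigma_n(x_1,\ldots,x_n)$. Then $x_1\cdot x_2\cdots x_{n-2}\leq \binom{n}{2}$. In particular, $x_{n-2}\leq\binom{n}{2}$.
   Context: For $k\leq n$, $\sigma_k(x_1,\ldots,x_n)=\sum_{i_1<i_2<\cdots<i_k}x_{i_1}\cdots x_{i_k}$ denotes the $k$-th elementary symmetric polynomial. -}

module Defs where

open import Data.Nat using (ℕ; zero; suc; _+_; _*_)
open import Data.Fin using (Fin; zero; suc)

-- σ k (x₁,…,xₙ) = Σ_{i₁<…<i_k} x_{i₁}⋯x_{i_k}, computed by the standard
-- recursion on n (split by whether the first index i₁ = 1 is used):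
--   σ 0 x = 1,  σ (k+1) () = 0,
--   σ (k+1) (x₁,x₂,…,xₙ) = x₁ · σ k (x₂,…,xₙ) + σ (k+1) (x₂,…,xₙ).
σ : (k : ℕ) → {n : ℕ} → (Fin n → ℕ) → ℕ
σ zero    x = 1
σ (suc k) {zero}  x = 0
σ (suc k) {suc n} x = x zero * σ k (λ i → x (suc i)) + σ (suc k) (λ i → x (suc i))

prodFirst : (m : ℕ) → {r : ℕ} → (Fin (m + r) → ℕ) → ℕ
prodFirst zero    x = 1
prodFirst (suc m) x = x zero * prodFirst m (λ i → x (suc i))

-- Every term x i x j of σ₂ is at most x_{n-1} x_n, so σ₂ ≤ C(n,2) x_{n-1} x_n, while
-- σₙ = (x₁⋯x_{n-2}) x_{n-1} x_n.  Cancelling x_{n-1} x_n from σₙ = σ₂ gives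
-- x₁⋯x_{n-2} ≤ C(n,2), and each x_i with i ≤ n-2 is a factor of that product.
module Submission where

open import Defs
open import Data.Nat using (ℕ; zero; suc; _+_; _*_; _≤_; _<_; z≤n; s≤s; >-nonZero)
open import Data.Nat.Properties
open import Data.Nat.Combinatorics using (_C_; nC1≡n; nCk+nC[k+1]≡[n+1]C[k+1])
open import Data.Fin using (Fin; toℕ; _↑ʳ_) renaming (zero to fz; suc to fs; _≤_ to _≤ᶠ_; _<_ to _<ᶠ_)
open import Data.Product using (_×_; _,_)
open import Relation.Binary.PropositionalEquality

private
  tail : ∀ {n} → (Fin (suc n) → ℕ) → Fin n → ℕ
  tail x i = x (fs i)

σ-vanishes : ∀ k {n} (y : Fin n → ℕ) → n < k → σ k y ≡ 0
σ-vanishes (suc k) {zero}  y _ = refl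
σ-vanishes (suc k) {suc n} y (s≤s n<k) = begin
  y fz * σ k (tail y) + σ (suc k) (tail y)
    ≡⟨ cong₂ _+_ (cong (y fz *_) (σ-vanishes k (tail y) n<k))
                 (σ-vanishes (suc k) (tail y) (m<n⇒m<1+n n<k)) ⟩
  y fz * 0 + 0
    ≡⟨ cong (_+ 0) (*-zeroʳ (y fz)) ⟩
  0 ∎
  where open ≡-Reasoning

σ-split : ∀ k {r} (x : Fin (k + r) → ℕ) → σ (k + r) x ≡ prodFirst k x * σ r (λ i → x (k ↑ʳ i))
σ-split zero    x = sym (*-identityˡ _)
σ-split (suc k) {r} x = begin
  x fz * σ (k + r) (tail x) + σ (suc (k + r)) (tail x)
    ≡⟨ cong₂ _+_ (cong (x fz *_) (σ-split k (tail x))) (σ-vanishes (suc (k + r)) (tail x) ≤-refl) ⟩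
  x fz * (prodFirst k (tail x) * σ r (λ i → x (suc k ↑ʳ i))) + 0
    ≡⟨ +-identityʳ _ ⟩
  x fz * (prodFirst k (tail x) * σ r (λ i → x (suc k ↑ʳ i)))
    ≡⟨ *-assoc (x fz) _ _ ⟨
  x fz * prodFirst k (tail x) * σ r (λ i → x (suc k ↑ʳ i)) ∎
  where open ≡-Reasoning

σ₂-pair : (y : Fin 2 → ℕ) → σ 2 y ≡ y fz * y (fs fz)
σ₂-pair y = begin
  y fz * (y (fs fz) * 1 + 0) + (y (fs fz) * 0 + 0)
    ≡⟨ cong₂ _+_ (cong (y fz *_) (trans (+-identityʳ _) (*-identityʳ _)))
                 (trans (+-identityʳ _) (*-zeroʳ (y (fs fz)))) ⟩
  y fz * y (fs fz) + 0
    ≡⟨ +-identityʳ _ ⟩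
  y fz * y (fs fz) ∎
  where open ≡-Reasoning

*-distribˡ-σ₁ : ∀ c {n} (y : Fin n → ℕ) → c * σ 1 y ≡ σ 1 (λ i → c * y i)
*-distribˡ-σ₁ c {zero}  y = *-zeroʳ c
*-distribˡ-σ₁ c {suc n} y = begin
  c * (y fz * 1 + σ 1 (tail y))
    ≡⟨ *-distribˡ-+ c (y fz * 1) (σ 1 (tail y)) ⟩
  c * (y fz * 1) + c * σ 1 (tail y)
    ≡⟨ cong₂ _+_ (sym (*-assoc c (y fz) 1)) (*-distribˡ-σ₁ c (tail y)) ⟩
  c * y fz * 1 + σ 1 (λ i → c * tail y i) ∎
  where open ≡-Reasoning

σ₁-bound : ∀ {n} B (y : Fin n → ℕ) → (∀ i → y i ≤ B) → σ 1 y ≤ n * B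
σ₁-bound {zero}  B y y≤B = z≤n
σ₁-bound {suc n} B y y≤B =
  +-mono-≤ (≤-trans (≤-reflexive (*-identityʳ (y fz))) (y≤B fz))
           (σ₁-bound B (tail y) (λ i → y≤B (fs i)))

σ₂-bound : ∀ {n} B (x : Fin n → ℕ) → (∀ i j → i <ᶠ j → x i * x j ≤ B) → σ 2 x ≤ (n C 2) * B
σ₂-bound {zero}  B x xx≤B = z≤n
σ₂-bound {suc n} B x xx≤B = begin
  x fz * σ 1 (tail x) + σ 2 (tail x)
    ≡⟨ cong (_+ σ 2 (tail x)) (*-distribˡ-σ₁ (x fz) (tail x)) ⟩
  σ 1 (λ i → x fz * tail x i) + σ 2 (tail x)
    ≤⟨ +-mono-≤ (σ₁-bound B _ (λ i → xx≤B fz (fs i) (s≤s z≤n)))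
                (σ₂-bound B (tail x) (λ i j i<j → xx≤B (fs i) (fs j) (s≤s i<j))) ⟩
  n * B + (n C 2) * B
    ≡⟨ *-distribʳ-+ B n (n C 2) ⟨
  (n + (n C 2)) * B
    ≡⟨ cong (λ c → (c + (n C 2)) * B) (nC1≡n n) ⟨
  ((n C 1) + (n C 2)) * B
    ≡⟨ cong (_* B) (nCk+nC[k+1]≡[n+1]C[k+1] n 1) ⟩
  (suc n C 2) * B ∎
  where open ≤-Reasoning

penultimate ultimate : ∀ m → Fin (m + 2)
penultimate m = m ↑ʳ fz
ultimate    m = m ↑ʳ fs fz

≤-penultimate : ∀ m (i j : Fin (m + 2)) → i <ᶠ j → i ≤ᶠ penultimate m
≤-penultimate zero    fz      _       _         = z≤n
≤-penultimate zero    (fs fz) (fs fz) (s≤s ())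
≤-penultimate (suc m) fz      _       _         = z≤n
≤-penultimate (suc m) (fs i)  (fs j)  (s≤s i<j) = s≤s (≤-penultimate m i j i<j)

≤-ultimate : ∀ m (j : Fin (m + 2)) → j ≤ᶠ ultimate m
≤-ultimate zero    fz      = z≤n
≤-ultimate zero    (fs fz) = s≤s z≤n
≤-ultimate (suc m) fz      = z≤n
≤-ultimate (suc m) (fs j)  = s≤s (≤-ultimate m j)

prodFirst-pos : ∀ m {r} (x : Fin (m + r) → ℕ) → (∀ i → 0 < x i) → 0 < prodFirst m x
prodFirst-pos zero    x pos = s≤s z≤n
prodFirst-pos (suc m) x pos = *-mono-≤ (pos fz) (prodFirst-pos m (tail x) (λ i → pos (fs i)))

entry≤prodFirst : ∀ m {r} (x : Fin (m + r) → ℕ) → (∀ i → 0 < x i)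
  → (i : Fin (m + r)) → toℕ i < m → x i ≤ prodFirst m x
entry≤prodFirst (suc m) x pos fz     _ =
  m≤m*n (x fz) (prodFirst m (tail x)) {{>-nonZero (prodFirst-pos m (tail x) (λ i → pos (fs i)))}}
entry≤prodFirst (suc m) x pos (fs i) (s≤s i<m) =
  ≤-trans (entry≤prodFirst m (tail x) (λ j → pos (fs j)) i i<m)
          (m≤n*m (prodFirst m (tail x)) (x fz) {{>-nonZero (pos fz)}})

lemma2p1 : (m : ℕ) → 1 ≤ m → (x : Fin (m + 2) → ℕ)
    → (∀ i → 0 < x i)
    → (∀ i j → i ≤ᶠ j → x i ≤ x j)
    → σ 2 x ≡ σ (m + 2) x
    → (prodFirst m x ≤ (m + 2) C 2)
      × (∀ (i : Fin (m + 2)) → suc (toℕ i) ≡ m → x i ≤ (m + 2) C 2)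
lemma2p1 m _ x pos mono σ₂≡σₙ = prod≤ , entry≤
  where
    top : ℕ
    top = x (penultimate m) * x (ultimate m)

    pair≤top : ∀ i j → i <ᶠ j → x i * x j ≤ top
    pair≤top i j i<j = *-mono-≤ (mono i _ (≤-penultimate m i j i<j)) (mono j _ (≤-ultimate m j))

    σₙ≡prod*top : σ (m + 2) x ≡ prodFirst m x * top
    σₙ≡prod*top = trans (σ-split m x) (cong (prodFirst m x *_) (σ₂-pair (λ i → x (m ↑ʳ i))))

    prod≤ : prodFirst m x ≤ (m + 2) C 2
    prod≤ = *-cancelʳ-≤ _ _ top {{>-nonZero (*-mono-≤ (pos _) (pos _))}}
      (≤-trans (≤-reflexive (trans (sym σₙ≡prod*top) (sym σ₂≡σₙ))) (σ₂-bound top x pair≤top))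

    entry≤ : ∀ i → suc (toℕ i) ≡ m → x i ≤ (m + 2) C 2
    entry≤ i i+1≡m = ≤-trans (entry≤prodFirst m x pos i (≤-reflexive i+1≡m)) prod≤
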